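{- There is an absolute constant $c > 0$ such that for all integers $p \ge 1$ and $n \ge p$ with $n$ a multiple of $p$, in the universal emptying game on $p$ processors and $n$ cups there is an adaptive filler strategy which, against every emptier, ensures that after step $\frac{n}{p}-1$ some cup contains at least $c\log\frac{n}{p}$ units of water.
   Context: Universal emptying game on $p$ processors and $n$ cups: $n$ cups, initially empty. In each step the filler distributes $p/2$ units of water among the cups (with no per-cup limit), and then the emptier selects $p$ cups and removes all of the water from each of them. An adaptive filler may base its choices on the emptier's previous actions. -}

module Defs where

open import Data.Nat as ℕ using (ℕ; zero; suc)
open import Data.Fin using (Fin) renaming (zero to fzero; suc to fsuc)
open import Data.Fin.Subset using (Subset; ∣_∣; Side; inside; outside)
open import Data.Vec using (lookup)
open import Data.Integer using (+_)
open import Data.Rational using (ℚ; 0ℚ; _+_; _≤_; _/_)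
open import Data.List using (List; []; _∷_; map)
open import Data.Product using (Σ; _,_)
open import Relation.Binary.PropositionalEquality using (_≡_)

sumℚ : ∀ {n} → (Fin n → ℚ) → ℚ
sumℚ {zero}  f = 0ℚ
sumℚ {suc n} f = f fzero + sumℚ (λ i → f (fsuc i))

record FillMove (n p : ℕ) : Set where
  field
    amount  : Fin n → ℚ
    nonneg  : ∀ i → 0ℚ ≤ amount i
    total   : sumℚ amount ≡ (+ p) / 2

EmptyMove : ℕ → ℕ → Set
EmptyMove n p = Σ (Subset n) (λ S → ∣ S ∣ ≡ p)

record Round (n p : ℕ) : Set where
  constructor round
  field
    fill  : FillMove n p
    empty : EmptyMove n p

-- Histories are stored most-recent-first.
-- An adaptive filler sees all previous emptier moves (its own previous
-- moves are determined by these, as it is deterministic).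
Filler : ℕ → ℕ → Set
Filler n p = List (EmptyMove n p) → FillMove n p

Emptier : ℕ → ℕ → Set
Emptier n p = List (Round n p) → FillMove n p → EmptyMove n p

history : ∀ {n p} → Filler n p → Emptier n p → ℕ → List (Round n p)
history F E zero    = []
history F E (suc t) =
  let h = history F E t
      f = F (map Round.empty h)
  in round f (E h f) ∷ h

emptyCup : Side → ℚ → ℚ
emptyCup inside  x = 0ℚ
emptyCup outside x = x

state : ∀ {n p} → List (Round n p) → Fin n → ℚ
state [] i = 0ℚ
state (round f (S , _) ∷ h) i =
  emptyCup (lookup S i) (state h i + FillMove.amount f i)

-- Let m = n/p. The filler keeps a set of active cups, of size (m − t)·p after t rounds, and in
-- round t + 1 spreads its p/2 units evenly over them, 1/(2(m − t)) per cup. The emptier can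
-- empty at most p active cups; the filler retires these together with arbitrary others, so that
-- the size (m − t − 1)·p is restored. A cup still active after t rounds therefore holds exactly
-- Σ_{j<t} 1/(2(m − j)); after m − 1 rounds p cups remain, each holding (H_m − 1)/2, and
-- H_m − 1 ≥ ½ log₂ m because the harmonic sum grows by at least ½ whenever its range doubles.
module Submission where

open import Defs
open import Data.Nat using (ℕ; _∸_)
open import Data.Nat.Divisibility using (_∣_)
open import Data.Nat.Logarithm using (⌊log₂_⌋)
open import Data.Fin using (Fin)
open import Data.Integer using (+_)
open import Data.Rational using (ℚ; 0ℚ; _<_; _≤_; _*_; _/_)
open import Data.Product using (Σ; ∃; _×_)

open import Data.Nat as ℕ using (zero; suc; NonZero; z≤n; s≤s)
import Data.Nat.Properties as ℕₚ
open import Data.Nat.Divisibility using (divides)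
open import Data.Nat.Logarithm using (⌊log₂⌊n/2⌋⌋≡⌊log₂n⌋∸1)
open import Data.Nat.Tactic.RingSolver using (solve-∀)
import Data.Integer as ℤ
import Data.Integer.Properties as ℤₚ
open import Data.Rational using (1ℚ; _+_; -_; fromℚᵘ)
open import Data.Rational.Properties
open import Data.Rational.Solver using (module +-*-Solver)
import Data.Rational.Unnormalised as ℚᵘ
import Data.Rational.Unnormalised.Properties as ℚᵘₚ
open import Data.Fin using () renaming (zero to fzero; suc to fsuc)
open import Data.Fin.Subset using (Subset; ⊤; ⁅_⁆; _─_; _∈_; _∉_; _⊆_; ∣_∣; Nonempty; Side; inside; outside)
open import Data.Fin.Subset.Properties using (∣⊤∣≡n; ∣⊥∣≡0; nonempty?; Empty-unique; p─q⊆p)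
open import Data.Vec using (_∷_; []; lookup)
open import Data.Vec.Base using (here; there)
open import Data.Vec.Properties using ([]=⇒lookup; lookup⇒[]=)
open import Data.List using (List; []; _∷_; map; length)
open import Data.List.Properties using (length-map)
open import Data.Product using (_,_; proj₁; proj₂)
open import Relation.Nullary using (yes; no; contradiction)
open import Relation.Binary.PropositionalEquality

fromℕ : ℕ → ℚ
fromℕ k = + k / 1

¼ : ℚ
¼ = + 1 / 4

fromℚᵘ-homo-+ : ∀ x y → fromℚᵘ (x ℚᵘ.+ y) ≡ fromℚᵘ x + fromℚᵘ y
fromℚᵘ-homo-+ x y = toℚᵘ-injective (ℚᵘₚ.≃-trans (toℚᵘ-fromℚᵘ (x ℚᵘ.+ y))
  (ℚᵘₚ.≃-sym (ℚᵘₚ.≃-trans (toℚᵘ-homo-+ (fromℚᵘ x) (fromℚᵘ y)) (ℚᵘₚ.+-cong (toℚᵘ-fromℚᵘ x) (toℚᵘ-fromℚᵘ y)))))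

fromℚᵘ-homo-* : ∀ x y → fromℚᵘ (x ℚᵘ.* y) ≡ fromℚᵘ x * fromℚᵘ y
fromℚᵘ-homo-* x y = toℚᵘ-injective (ℚᵘₚ.≃-trans (toℚᵘ-fromℚᵘ (x ℚᵘ.* y))
  (ℚᵘₚ.≃-sym (ℚᵘₚ.≃-trans (toℚᵘ-homo-* (fromℚᵘ x) (fromℚᵘ y)) (ℚᵘₚ.*-cong (toℚᵘ-fromℚᵘ x) (toℚᵘ-fromℚᵘ y)))))

fromℚᵘ-mono-≤ : ∀ {x y} → x ℚᵘ.≤ y → fromℚᵘ x ≤ fromℚᵘ y
fromℚᵘ-mono-≤ {x} {y} x≤y = toℚᵘ-cancel-≤
  (ℚᵘₚ.≤-respˡ-≃ (ℚᵘₚ.≃-sym (toℚᵘ-fromℚᵘ x)) (ℚᵘₚ.≤-respʳ-≃ (ℚᵘₚ.≃-sym (toℚᵘ-fromℚᵘ y)) x≤y))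

/-≡ : ∀ a b c d .{{_ : NonZero b}} .{{_ : NonZero d}} → a ℕ.* d ≡ c ℕ.* b → + a / b ≡ + c / d
/-≡ a zero c d {{()}}
/-≡ a (suc b) c zero {{_}} {{()}}
/-≡ a (suc b) c (suc d) eq = fromℚᵘ-cong {ℚᵘ.mkℚᵘ (+ a) b} {ℚᵘ.mkℚᵘ (+ c) d}
  (ℚᵘ.*≡* (trans (sym (ℤₚ.pos-* a (suc d))) (trans (cong +_ eq) (ℤₚ.pos-* c (suc b)))))

/-≤ : ∀ a b c d .{{_ : NonZero b}} .{{_ : NonZero d}} → a ℕ.* d ℕ.≤ c ℕ.* b → + a / b ≤ + c / d
/-≤ a zero c d {{()}}
/-≤ a (suc b) c zero {{_}} {{()}}
/-≤ a (suc b) c (suc d) le = fromℚᵘ-mono-≤ {ℚᵘ.mkℚᵘ (+ a) b} {ℚᵘ.mkℚᵘ (+ c) d}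
  (ℚᵘ.*≤* (subst₂ ℤ._≤_ (ℤₚ.pos-* a (suc d)) (ℤₚ.pos-* c (suc b)) (ℤ.+≤+ le)))

/-+ : ∀ a b c d .{{_ : NonZero b}} .{{_ : NonZero d}} →
      + a / b + + c / d ≡ (+ (a ℕ.* d ℕ.+ c ℕ.* b) / (b ℕ.* d)) {{ℕₚ.m*n≢0 b d}}
/-+ a zero c d {{()}}
/-+ a (suc b) c zero {{_}} {{()}}
/-+ a (suc b) c (suc d) = trans (sym (fromℚᵘ-homo-+ (ℚᵘ.mkℚᵘ (+ a) b) (ℚᵘ.mkℚᵘ (+ c) d)))
  (cong (λ z → z / (suc b ℕ.* suc d))
    (trans (cong₂ ℤ._+_ (sym (ℤₚ.pos-* a (suc d))) (sym (ℤₚ.pos-* c (suc b))))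
           (sym (ℤₚ.pos-+ (a ℕ.* suc d) (c ℕ.* suc b)))))

/-* : ∀ a b c d .{{_ : NonZero b}} .{{_ : NonZero d}} →
      + a / b * (+ c / d) ≡ (+ (a ℕ.* c) / (b ℕ.* d)) {{ℕₚ.m*n≢0 b d}}
/-* a zero c d {{()}}
/-* a (suc b) c zero {{_}} {{()}}
/-* a (suc b) c (suc d) = trans (sym (fromℚᵘ-homo-* (ℚᵘ.mkℚᵘ (+ a) b) (ℚᵘ.mkℚᵘ (+ c) d)))
  (cong (λ z → z / (suc b ℕ.* suc d)) (sym (ℤₚ.pos-* a c)))

fromℕ-+ : ∀ a b → fromℕ (a ℕ.+ b) ≡ fromℕ a + fromℕ b
fromℕ-+ a b = sym (trans (/-+ a 1 b 1) (/-≡ (a ℕ.* 1 ℕ.+ b ℕ.* 1) 1 (a ℕ.+ b) 1 (cross a b)))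
  where
  cross : ∀ a b → (a ℕ.* 1 ℕ.+ b ℕ.* 1) ℕ.* 1 ≡ (a ℕ.+ b) ℕ.* 1
  cross = solve-∀

fromℕ-suc : ∀ k → fromℕ (suc k) ≡ 1ℚ + fromℕ k
fromℕ-suc = fromℕ-+ 1

+-cancelʳ-≤ : ∀ r {p q} → p + r ≤ q + r → p ≤ q
+-cancelʳ-≤ r {p} {q} p+r≤q+r = subst₂ _≤_ (+-cancel p) (+-cancel q) (+-monoˡ-≤ (- r) p+r≤q+r)
  where
  +-cancel : ∀ x → x + r + - r ≡ x
  +-cancel x = trans (+-assoc x r (- r)) (trans (cong (_+_ x) (+-inverseʳ r)) (+-identityʳ x))

share : ℕ → ℚ
share r = + 1 / (2 ℕ.* suc r)

share-nonneg : ∀ r → 0ℚ ≤ share r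
share-nonneg r = /-≤ 0 1 1 (2 ℕ.* suc r) z≤n

share-antitone : ∀ {r s} → r ℕ.≤ s → share s ≤ share r
share-antitone {r} {s} r≤s =
  /-≤ 1 (2 ℕ.* suc s) 1 (2 ℕ.* suc r) (ℕₚ.*-monoʳ-≤ 1 (ℕₚ.*-monoʳ-≤ 2 (s≤s r≤s)))

fromℕ-*-share : ∀ r p → fromℕ (suc r ℕ.* p) * share r ≡ + p / 2
fromℕ-*-share r p = trans (/-* (suc r ℕ.* p) 1 1 (2 ℕ.* suc r))
  (/-≡ (suc r ℕ.* p ℕ.* 1) (1 ℕ.* (2 ℕ.* suc r)) p 2 (cross r p))
  where
  cross : ∀ r p → suc r ℕ.* p ℕ.* 1 ℕ.* 2 ≡ p ℕ.* (1 ℕ.* (2 ℕ.* suc r))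
  cross = solve-∀

fromℕ-*-share-double : ∀ k → fromℕ (suc k) * share (k ℕ.+ suc k) ≡ ¼
fromℕ-*-share-double k = trans (/-* (suc k) 1 1 (2 ℕ.* suc (k ℕ.+ suc k)))
  (/-≡ (suc k ℕ.* 1) (1 ℕ.* (2 ℕ.* suc (k ℕ.+ suc k))) 1 4 (cross k))
  where
  cross : ∀ k → suc k ℕ.* 1 ℕ.* 4 ≡ 1 ℕ.* (1 ℕ.* (2 ℕ.* suc (k ℕ.+ suc k)))
  cross = solve-∀

halfHarmonic : ℕ → ℚ
halfHarmonic zero    = 0ℚ
halfHarmonic (suc k) = share k + halfHarmonic k

halfHarmonic-mono : ∀ {a b} → a ℕ.≤ b → halfHarmonic a ≤ halfHarmonic b
halfHarmonic-mono a≤b = mono′ (ℕₚ.≤⇒≤′ a≤b)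
  where
  mono′ : ∀ {a b} → a ℕ.≤′ b → halfHarmonic a ≤ halfHarmonic b
  mono′ ℕ.≤′-refl                = ≤-refl
  mono′ (ℕ.≤′-step {b} a≤′b) = ≤-trans (mono′ a≤′b)
    (subst (_≤ halfHarmonic (suc b)) (+-identityˡ (halfHarmonic b)) (+-monoˡ-≤ (halfHarmonic b) (share-nonneg b)))

halfHarmonic-tail : ∀ {N} k j → k ℕ.+ j ℕ.≤ suc N →
                    halfHarmonic k + fromℕ j * share N ≤ halfHarmonic (k ℕ.+ j)
halfHarmonic-tail {N} k zero _ = ≤-reflexive (begin
    halfHarmonic k + 0ℚ * share N ≡⟨ cong (_+_ (halfHarmonic k)) (*-zeroˡ (share N)) ⟩
    halfHarmonic k + 0ℚ           ≡⟨ +-identityʳ (halfHarmonic k) ⟩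
    halfHarmonic k                ≡⟨ cong halfHarmonic (sym (ℕₚ.+-identityʳ k)) ⟩
    halfHarmonic (k ℕ.+ 0)        ∎)
  where open ≡-Reasoning
halfHarmonic-tail {N} k (suc j) k+1+j≤1+N = begin
    halfHarmonic k + fromℕ (suc j) * share N
      ≡⟨ cong (λ x → halfHarmonic k + x * share N) (fromℕ-suc j) ⟩
    halfHarmonic k + (1ℚ + fromℕ j) * share N
      ≡⟨ regroup (halfHarmonic k) (fromℕ j) (share N) ⟩
    (halfHarmonic k + fromℕ j * share N) + share N
      ≤⟨ +-mono-≤ (halfHarmonic-tail k j (ℕₚ.m≤n⇒m≤1+n k+j≤N)) (share-antitone k+j≤N) ⟩
    halfHarmonic (k ℕ.+ j) + share (k ℕ.+ j)
      ≡⟨ +-comm (halfHarmonic (k ℕ.+ j)) (share (k ℕ.+ j)) ⟩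
    halfHarmonic (suc (k ℕ.+ j))
      ≡⟨ cong halfHarmonic (sym (ℕₚ.+-suc k j)) ⟩
    halfHarmonic (k ℕ.+ suc j) ∎
  where
  open ≤-Reasoning
  open +-*-Solver
  k+j≤N : k ℕ.+ j ℕ.≤ N
  k+j≤N = ℕ.s≤s⁻¹ (subst (ℕ._≤ suc N) (ℕₚ.+-suc k j) k+1+j≤1+N)
  regroup : ∀ h x s → h + (1ℚ + x) * s ≡ (h + x * s) + s
  regroup = solve 3 (λ h x s → h :+ (con 1ℚ :+ x) :* s := (h :+ x :* s) :+ s) refl

halfHarmonic-double : ∀ k → halfHarmonic (suc k) + ¼ ≤ halfHarmonic (suc k ℕ.+ suc k)
halfHarmonic-double k = subst (λ x → halfHarmonic (suc k) + x ≤ halfHarmonic (suc k ℕ.+ suc k))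
  (fromℕ-*-share-double k) (halfHarmonic-tail (suc k) (suc k) ℕₚ.≤-refl)

halfHarmonic-log : ∀ L m → ⌊log₂ suc m ⌋ ≡ L → ¼ * fromℕ L + halfHarmonic 1 ≤ halfHarmonic (suc m)
halfHarmonic-log zero m _ = begin
  ¼ * 0ℚ + halfHarmonic 1 ≡⟨ cong (_+ halfHarmonic 1) (*-zeroʳ ¼) ⟩
  0ℚ + halfHarmonic 1     ≡⟨ +-identityˡ (halfHarmonic 1) ⟩
  halfHarmonic 1          ≤⟨ halfHarmonic-mono {b = suc m} (s≤s z≤n) ⟩
  halfHarmonic (suc m)    ∎
  where open ≤-Reasoning
halfHarmonic-log (suc L) zero ()
halfHarmonic-log (suc L) (suc m) log[2+m]≡1+L = begin
    ¼ * fromℕ (suc L) + halfHarmonic 1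
      ≡⟨ cong (λ x → ¼ * x + halfHarmonic 1) (fromℕ-suc L) ⟩
    ¼ * (1ℚ + fromℕ L) + halfHarmonic 1
      ≡⟨ regroup ¼ (fromℕ L) (halfHarmonic 1) ⟩
    (¼ * fromℕ L + halfHarmonic 1) + ¼
      ≤⟨ +-monoˡ-≤ ¼ (halfHarmonic-log L k log[1+k]≡L) ⟩
    halfHarmonic (suc k) + ¼
      ≤⟨ halfHarmonic-double k ⟩
    halfHarmonic (suc k ℕ.+ suc k)
      ≤⟨ halfHarmonic-mono 2+2k≤2+m ⟩
    halfHarmonic (suc (suc m)) ∎
  where
  open ≤-Reasoning
  open +-*-Solver
  k : ℕ
  k = ℕ.⌊ m /2⌋
  log[1+k]≡L : ⌊log₂ suc k ⌋ ≡ L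
  log[1+k]≡L = trans (⌊log₂⌊n/2⌋⌋≡⌊log₂n⌋∸1 (suc (suc m))) (cong (_∸ 1) log[2+m]≡1+L)
  2+2k≤2+m : suc k ℕ.+ suc k ℕ.≤ suc (suc m)
  2+2k≤2+m = s≤s (subst (ℕ._≤ suc m) (sym (ℕₚ.+-suc k k))
    (s≤s (subst (k ℕ.+ k ℕ.≤_) (ℕₚ.⌊n/2⌋+⌈n/2⌉≡n m) (ℕₚ.+-monoʳ-≤ k (ℕₚ.⌊n/2⌋≤⌈n/2⌉ m)))))
  regroup : ∀ c x g → c * (1ℚ + x) + g ≡ (c * x + g) + c
  regroup = solve 3 (λ c x g → c :* (con 1ℚ :+ x) :+ g := (c :* x :+ g) :+ c) refl

keepFirst : ∀ {n} → ℕ → Subset n → Subset n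
keepFirst k       []            = []
keepFirst k       (outside ∷ A) = outside ∷ keepFirst k A
keepFirst zero    (inside ∷ A)  = outside ∷ keepFirst zero A
keepFirst (suc k) (inside ∷ A)  = inside ∷ keepFirst k A

keepFirst-⊆ : ∀ {n} k (A : Subset n) → keepFirst k A ⊆ A
keepFirst-⊆ k       (outside ∷ A) (there x∈) = there (keepFirst-⊆ k A x∈)
keepFirst-⊆ zero    (inside ∷ A)  (there x∈) = there (keepFirst-⊆ zero A x∈)
keepFirst-⊆ (suc k) (inside ∷ A)  here       = here
keepFirst-⊆ (suc k) (inside ∷ A)  (there x∈) = there (keepFirst-⊆ k A x∈)

∣keepFirst∣ : ∀ {n} k (A : Subset n) → k ℕ.≤ ∣ A ∣ → ∣ keepFirst k A ∣ ≡ k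
∣keepFirst∣ zero    []            _         = refl
∣keepFirst∣ k       (outside ∷ A) k≤∣A∣     = ∣keepFirst∣ k A k≤∣A∣
∣keepFirst∣ zero    (inside ∷ A)  _         = ∣keepFirst∣ zero A z≤n
∣keepFirst∣ (suc k) (inside ∷ A)  (s≤s k≤) = cong suc (∣keepFirst∣ k A k≤)

x∈p─q⇒x∉q : ∀ {n} {x : Fin n} (p q : Subset n) → x ∈ p ─ q → x ∉ q
x∈p─q⇒x∉q (_ ∷ p) (_ ∷ q)       (there x∈p─q) (there x∈q) = x∈p─q⇒x∉q p q x∈p─q x∈q

∣p∣≤∣q∣+∣p─q∣ : ∀ {n} (p q : Subset n) → ∣ p ∣ ℕ.≤ ∣ q ∣ ℕ.+ ∣ p ─ q ∣
∣p∣≤∣q∣+∣p─q∣ []            []            = z≤n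
∣p∣≤∣q∣+∣p─q∣ (inside ∷ p)  (inside ∷ q)  = s≤s (∣p∣≤∣q∣+∣p─q∣ p q)
∣p∣≤∣q∣+∣p─q∣ (inside ∷ p)  (outside ∷ q) =
  subst (suc ∣ p ∣ ℕ.≤_) (sym (ℕₚ.+-suc ∣ q ∣ ∣ p ─ q ∣)) (s≤s (∣p∣≤∣q∣+∣p─q∣ p q))
∣p∣≤∣q∣+∣p─q∣ (outside ∷ p) (inside ∷ q)  = ℕₚ.m≤n⇒m≤1+n (∣p∣≤∣q∣+∣p─q∣ p q)
∣p∣≤∣q∣+∣p─q∣ (outside ∷ p) (outside ∷ q) = ∣p∣≤∣q∣+∣p─q∣ p q

∣⁅x⁆∣≡1 : ∀ {n} (x : Fin n) → ∣ ⁅ x ⁆ ∣ ≡ 1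
∣⁅x⁆∣≡1 {suc n} fzero    = cong suc (∣⊥∣≡0 n)
∣⁅x⁆∣≡1         (fsuc x) = ∣⁅x⁆∣≡1 x

0<∣p∣⇒Nonempty : ∀ {n} (p : Subset n) → 0 ℕ.< ∣ p ∣ → Nonempty p
0<∣p∣⇒Nonempty {n} p 0<∣p∣ with nonempty? p
... | yes p≢∅ = p≢∅
... | no  p≡∅ = contradiction (trans (cong ∣_∣ (Empty-unique p≡∅)) (∣⊥∣≡0 n)) (ℕₚ.>⇒≢ 0<∣p∣)

onInside : Side → ℚ → ℚ
onInside inside  x = x
onInside outside _ = 0ℚ

spread : ∀ {n} → Subset n → ℚ → Fin n → ℚ
spread A x i = onInside (lookup A i) x

spread-∈ : ∀ {n} {A : Subset n} {i} x → i ∈ A → spread A x i ≡ x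
spread-∈ x i∈A = cong (λ s → onInside s x) ([]=⇒lookup i∈A)

spread-nonneg : ∀ {n} (A : Subset n) {x} → 0ℚ ≤ x → ∀ i → 0ℚ ≤ spread A x i
spread-nonneg A 0≤x i with lookup A i
... | inside  = 0≤x
... | outside = ≤-refl

sumℚ-spread : ∀ {n} (A : Subset n) x → sumℚ (spread A x) ≡ fromℕ ∣ A ∣ * x
sumℚ-spread []            x = sym (*-zeroˡ x)
sumℚ-spread (outside ∷ A) x = trans (+-identityˡ _) (sumℚ-spread A x)
sumℚ-spread (inside ∷ A)  x = begin
    x + sumℚ (spread A x)        ≡⟨ cong (_+_ x) (sumℚ-spread A x) ⟩
    x + fromℕ ∣ A ∣ * x          ≡⟨ factor x (fromℕ ∣ A ∣) ⟩
    (1ℚ + fromℕ ∣ A ∣) * x       ≡⟨ cong (_* x) (sym (fromℕ-suc ∣ A ∣)) ⟩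
    fromℕ (suc ∣ A ∣) * x        ∎
  where
  open ≡-Reasoning
  open +-*-Solver
  factor : ∀ x a → x + a * x ≡ (1ℚ + a) * x
  factor = solve 2 (λ x a → x :+ a :* x := (con 1ℚ :+ a) :* x) refl

spreadFill : ∀ {n p} (A : Subset n) x → 0ℚ ≤ x → fromℕ ∣ A ∣ * x ≡ + p / 2 → FillMove n p
spreadFill A x 0≤x ∣A∣x≡p/2 = record
  { amount = spread A x
  ; nonneg = spread-nonneg A 0≤x
  ; total  = trans (sumℚ-spread A x) ∣A∣x≡p/2
  }

pourInto : ∀ {n} p → Fin n → FillMove n p
pourInto p i = spreadFill ⁅ i ⁆ (+ p / 2) (/-≤ 0 1 p 2 z≤n)
  (trans (cong (λ k → fromℕ k * (+ p / 2)) (∣⁅x⁆∣≡1 i)) (*-identityˡ (+ p / 2)))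

state-∉ : ∀ {n p} {f : FillMove n p} {S : Subset n} {∣S∣≡p : ∣ S ∣ ≡ p} {h} {i} → i ∉ S →
          state (round f (S , ∣S∣≡p) ∷ h) i ≡ state h i + FillMove.amount f i
state-∉ {S = S} {i = i} i∉S with lookup S i in S[i]
... | inside  = contradiction (lookup⇒[]= i S S[i]) i∉S
... | outside = refl

length-history : ∀ {n p} (F : Filler n p) (E : Emptier n p) t → length (history F E t) ≡ t
length-history F E zero    = refl
length-history F E (suc t) = cong suc (length-history F E t)

module ShrinkingFiller {n p : ℕ} (m : ℕ) (n≡m*p : n ≡ m ℕ.* p) (fallback : FillMove n p) where

  active : List (EmptyMove n p) → Subset n
  active []            = ⊤
  active ((S , _) ∷ h) = keepFirst (∣ active h ∣ ∸ p) (active h ─ S)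

  ∣active∣ : ∀ h → ∣ active h ∣ ≡ (m ∸ length h) ℕ.* p
  ∣active∣ []                = trans (∣⊤∣≡n n) n≡m*p
  ∣active∣ ((S , ∣S∣≡p) ∷ h) = trans (∣keepFirst∣ (∣ active h ∣ ∸ p) (active h ─ S) enough) shrink
    where
    open ≡-Reasoning
    l : ℕ
    l = length h
    enough : ∣ active h ∣ ∸ p ℕ.≤ ∣ active h ─ S ∣
    enough = ℕₚ.m≤n+o⇒m∸n≤o ∣ active h ∣ p
      (subst (λ k → ∣ active h ∣ ℕ.≤ k ℕ.+ ∣ active h ─ S ∣) ∣S∣≡p (∣p∣≤∣q∣+∣p─q∣ (active h) S))
    shrink : ∣ active h ∣ ∸ p ≡ (m ∸ suc l) ℕ.* p
    shrink = begin
      ∣ active h ∣ ∸ p           ≡⟨ cong (_∸ p) (∣active∣ h) ⟩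
      (m ∸ l) ℕ.* p ∸ p          ≡⟨ cong ((m ∸ l) ℕ.* p ∸_) (sym (ℕₚ.*-identityˡ p)) ⟩
      (m ∸ l) ℕ.* p ∸ 1 ℕ.* p    ≡⟨ sym (ℕₚ.*-distribʳ-∸ p (m ∸ l) 1) ⟩
      (m ∸ l ∸ 1) ℕ.* p          ≡⟨ cong (ℕ._* p) (trans (ℕₚ.∸-+-assoc m l 1) (cong (m ∸_) (ℕₚ.+-comm l 1))) ⟩
      (m ∸ suc l) ℕ.* p          ∎

  fillActive : (A : Subset n) (k : ℕ) → ∣ A ∣ ≡ k ℕ.* p → FillMove n p
  fillActive A zero    _    = fallback  -- reached only after round m, which the bound never inspects
  fillActive A (suc r) ∣A∣≡ = spreadFill A (share r) (share-nonneg r)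
    (trans (cong (λ k → fromℕ k * share r) ∣A∣≡) (fromℕ-*-share r p))

  fillActive-∈ : ∀ {A k r i} (∣A∣≡ : ∣ A ∣ ≡ k ℕ.* p) → k ≡ suc r → i ∈ A →
                 FillMove.amount (fillActive A k ∣A∣≡) i ≡ share r
  fillActive-∈ {r = r} _ refl = spread-∈ (share r)

  filler : Filler n p
  filler h = fillActive (active h) (m ∸ length h) (∣active∣ h)

  module _ (E : Emptier n p) where

    emptied : ℕ → List (EmptyMove n p)
    emptied t = map Round.empty (history filler E t)

    length-emptied : ∀ t → length (emptied t) ≡ t
    length-emptied t = trans (length-map Round.empty (history filler E t)) (length-history filler E t)

    state-active : ∀ t → t ℕ.≤ m → ∀ {i} → i ∈ active (emptied t) →
                   state (history filler E t) i + halfHarmonic (m ∸ t) ≡ halfHarmonic m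
    state-active zero    _   _  = +-identityˡ (halfHarmonic m)
    state-active (suc t) t<m {i} i∈ = begin
        state (history filler E (suc t)) i + halfHarmonic (m ∸ suc t)
          ≡⟨ cong (_+ halfHarmonic (m ∸ suc t)) (state-∉ {f = f} {∣S∣≡p = proj₂ (E h f)} {h = h} (x∈p─q⇒x∉q (active es) S i∈A─S)) ⟩
        (state h i + FillMove.amount f i) + halfHarmonic (m ∸ suc t)
          ≡⟨ cong (λ x → (state h i + x) + halfHarmonic (m ∸ suc t)) (fillActive-∈ (∣active∣ es) m∸l≡1+m∸[1+t] i∈A) ⟩
        (state h i + share (m ∸ suc t)) + halfHarmonic (m ∸ suc t)
          ≡⟨ +-assoc (state h i) _ _ ⟩
        state h i + halfHarmonic (suc (m ∸ suc t))
          ≡⟨ cong (λ k → state h i + halfHarmonic k) (sym m∸t≡1+m∸[1+t]) ⟩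
        state h i + halfHarmonic (m ∸ t)
          ≡⟨ state-active t (ℕₚ.<⇒≤ t<m) i∈A ⟩
        halfHarmonic m ∎
      where
      open ≡-Reasoning
      h : List (Round n p)
      h = history filler E t
      es : List (EmptyMove n p)
      es = emptied t
      f : FillMove n p
      f = filler es
      S : Subset n
      S = proj₁ (E h f)
      i∈A─S : i ∈ active es ─ S
      i∈A─S = keepFirst-⊆ _ (active es ─ S) i∈
      i∈A : i ∈ active es
      i∈A = p─q⊆p (active es) S i∈A─S
      m∸t≡1+m∸[1+t] : m ∸ t ≡ suc (m ∸ suc t)
      m∸t≡1+m∸[1+t] = ℕₚ.+-∸-assoc 1 t<m
      m∸l≡1+m∸[1+t] : m ∸ length es ≡ suc (m ∸ suc t)
      m∸l≡1+m∸[1+t] = trans (cong (m ∸_) (length-emptied t)) m∸t≡1+m∸[1+t]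

shrinkingFiller-wins : ∀ {n p} m (n≡[1+m]p : n ≡ suc m ℕ.* p) (fallback : FillMove n p) → 0 ℕ.< p →
  (E : Emptier n p) → ∃ λ i →
  ¼ * fromℕ ⌊log₂ suc m ⌋ ≤ state (history (ShrinkingFiller.filler (suc m) n≡[1+m]p fallback) E m) i
shrinkingFiller-wins {n} {p} m n≡[1+m]p fallback 0<p E = i , +-cancelʳ-≤ (halfHarmonic 1) (begin
    ¼ * fromℕ ⌊log₂ suc m ⌋ + halfHarmonic 1  ≤⟨ halfHarmonic-log _ m refl ⟩
    halfHarmonic (suc m)                       ≡⟨ sym level ⟩
    state h i + halfHarmonic 1                 ∎)
  where
  open ShrinkingFiller (suc m) n≡[1+m]p fallback
  open ≤-Reasoning
  h : List (Round n p)
  h = history filler E m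
  1+m∸m≡1 : suc m ∸ m ≡ 1
  1+m∸m≡1 = ℕₚ.m+n∸n≡m 1 m
  ∣A∣≡p : ∣ active (emptied E m) ∣ ≡ p
  ∣A∣≡p = trans (∣active∣ (emptied E m))
    (trans (cong (λ t → (suc m ∸ t) ℕ.* p) (length-emptied E m))
    (trans (cong (ℕ._* p) 1+m∸m≡1) (ℕₚ.*-identityˡ p)))
  cup : Nonempty (active (emptied E m))
  cup = 0<∣p∣⇒Nonempty _ (subst (0 ℕ.<_) (sym ∣A∣≡p) 0<p)
  i : Fin n
  i = proj₁ cup
  level : state h i + halfHarmonic 1 ≡ halfHarmonic (suc m)
  level = subst (λ k → state h i + halfHarmonic k ≡ halfHarmonic (suc m)) 1+m∸m≡1
    (state-active E m (ℕₚ.n≤1+n m) (proj₂ cup))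

theorem8p1 : Σ ℚ (λ c → (0ℚ < c) × ((p n : ℕ) → 1 Data.Nat.≤ p → p Data.Nat.≤ n → (d : p ∣ n) → Σ (Filler n p) (λ F → (E : Emptier n p) → ∃ (λ (i : Fin n) → c * ((+ ⌊log₂ (_∣_.quotient d) ⌋) / 1) ≤ state (history F E (_∣_.quotient d ∸ 1)) i))))
theorem8p1 = ¼ , positive⁻¹ ¼ , filler-for
  where
  filler-for : (p n : ℕ) → 1 ℕ.≤ p → p ℕ.≤ n → (d : p ∣ n) → Σ (Filler n p) (λ F → (E : Emptier n p) →
    ∃ (λ (i : Fin n) → ¼ * fromℕ ⌊log₂ (_∣_.quotient d) ⌋ ≤ state (history F E (_∣_.quotient d ∸ 1)) i))
  filler-for p n 1≤p p≤n (divides zero n≡0) = contradiction (ℕₚ.≤-trans 1≤p (subst (p ℕ.≤_) n≡0 p≤n)) λ ()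
  filler-for p n 1≤p p≤n (divides (suc m) n≡[1+m]p) =
    ShrinkingFiller.filler (suc m) n≡[1+m]p fallback , shrinkingFiller-wins m n≡[1+m]p fallback 1≤p
    where
    fallback : FillMove n p
    fallback = pourInto p (Data.Fin.fromℕ< (ℕₚ.≤-trans 1≤p p≤n))
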